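{- With the operations $\wedge$ (conjunction) and $\vee$ (disjunction), the class of DMTS and the class of NAA over a finite alphabet $\Sigma$ each form bounded distributive lattices up to $\equiv_m$; i.e. modulo $\equiv_m$, ordered by $\le_m$, each class is a bounded lattice with meet $\wedge$ and join $\vee$ satisfying the distributive laws.
   Context: NAA: $(S,S^0,\mathrm{Tran})$, $S^0\subseteq S$ finite, $\mathrm{Tran}:S\to 2^{\mathcal P_{\mathrm{fin}}(\Sigma\times S)}$; NAA modal refinement $R$: for $(s_1,s_2)\in R$ and $M_1\in\mathrm{Tran}_1(s_1)$ there is $M_2\in\mathrm{Tran}_2(s_2)$ such that each $(a,t_1)\in M_1$ is matched by some $(a,t_2)\in M_2$ with $(t_1,t_2)\in R$ and vice versa. DMTS: $(S,S^0,\dashrightarrow,\longrightarrow)$ with $S^0$ finite, image-finite may relation $\dashrightarrow\subseteq S\times\Sigma\times S$ and must relation $\longrightarrow\subseteq S\times 2^{\Sigma\times S}$, with $s\longrightarrow N,(a,t)\in N\Rightarrow s\overset a\dashrightarrow t$; DMTS modal refinement $R$: for $(s_1,s_2)\in R$, each $s_1\overset a\dashrightarrow t_1$ is matched by some $s_2\overset a\dashrightarrow t_2$ with $(t_1,t_2)\in R$, and each $s_2\longrightarrow N_2$ by some $s_1\longrightarrow N_1$ with each $(a,t_1)\in N_1$ having $(a,t_2)\in N_2$, $(t_1,t_2)\in R$. A refinement is initialised if each left initial state is related to some right initial state; $S_1\le_m S_2$ iff one exists; $S_1\equiv_m S_2$ iff $S_1\le_m S_2$ and $S_2\le_m S_1$.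 Disjunction (disjoint union): NAA $S_1\vee S_2=(S_1\cup S_2,S_1^0\cup S_2^0,\mathrm{Tran}_1\cup\mathrm{Tran}_2)$; DMTS $S_1\vee S_2=(S_1\cup S_2,S_1^0\cup S_2^0,\dashrightarrow_1\cup\dashrightarrow_2,\longrightarrow_1\cup\longrightarrow_2)$. Conjunction: NAA $S_1\wedge S_2=(S_1\times S_2,S_1^0\times S_2^0,\mathrm{Tran})$ with $\mathrm{Tran}((s_1,s_2))=\{M\subseteq\Sigma\times S_1\times S_2\mid\pi_1(M)\in\mathrm{Tran}_1(s_1),\pi_2(M)\in\mathrm{Tran}_2(s_2)\}$, $\pi_1(M)=\{(a,s_1)\mid\exists s_2:(a,s_1,s_2)\in M\}$, $\pi_2$ symmetric. DMTS $S_1\wedge S_2=(S_1\times S_2,S_1^0\times S_2^0,\dashrightarrow,\longrightarrow)$ with $(s_1,s_2)\overset a\dashrightarrow(t_1,t_2)$ iff $s_1\overset a\dashrightarrow_1t_1$ and $s_2\overset a\dashrightarrow_2t_2$; for each $s_1\longrightarrow_1N_1$, $(s_1,s_2)\longrightarrow\{(a,(t_1,t_2))\mid(a,t_1)\in N_1,(s_1,s_2)\overset a\dashrightarrow(t_1,t_2)\}$, and symmetrically for each $s_2\longrightarrow_2N_2$. -}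

module Defs where

open import Data.Nat using (ℕ)
open import Data.Fin using (Fin; _≟_)
open import Data.Product using (Σ; ∃; ∃-syntax; _×_; _,_; proj₁; proj₂; map₂)
open import Data.Sum using (_⊎_; inj₁; inj₂)
open import Data.List using (List; []; _∷_; map; _++_; cartesianProduct; concatMap)
open import Data.List.Relation.Unary.Any using (Any; here; there)
open import Data.List.Membership.Propositional using (_∈_)
open import Data.List.Membership.Propositional.Properties
  using (∈-map⁺; ∈-map⁻; ∈-concatMap⁺)
open import Function.Bundles using (_⇔_; Equivalence)
open import Relation.Nullary using (yes; no)
open import Data.Empty using (⊥-elim)
open import Relation.Binary.PropositionalEquality using (_≡_; refl; subst; sym)

-- Conventions.
-- * The finite alphabet Σ is `Fin k`.
-- * A finite set of elements of A is represented by a list (its elements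
--   are what is given by `_∈_`; order / duplicates are irrelevant to every
--   notion below).
-- * Action labels: Act k S = Σ × S pairs.

Act : ℕ → Set → Set
Act k S = Fin k × S

-- Nondeterministic acceptance automata (NAA)
--   S^0 finite  : list of initial states
--   Tran s      : a set of finite subsets of Σ × S, given as a predicate
--                 on (list representations of) finite subsets.

record NAA (k : ℕ) : Set₁ where
  field
    St   : Set
    init : List St
    Tran : St → List (Act k St) → Set

module _ {k : ℕ} (A B : NAA k) where
  private
    module A = NAA A
    module B = NAA B

  IsNAARefinement : (A.St → B.St → Set) → Set
  IsNAARefinement R =
    ∀ s₁ s₂ → R s₁ s₂ → ∀ M₁ → A.Tran s₁ M₁ →
      ∃[ M₂ ] (B.Tran s₂ M₂
        × (∀ a t₁ → (a , t₁) ∈ M₁ → ∃[ t₂ ] ((a , t₂) ∈ M₂ × R t₁ t₂))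
        × (∀ a t₂ → (a , t₂) ∈ M₂ → ∃[ t₁ ] ((a , t₁) ∈ M₁ × R t₁ t₂)))

  NAAInitialised : (A.St → B.St → Set) → Set
  NAAInitialised R = ∀ s₁ → s₁ ∈ A.init → ∃[ s₂ ] (s₂ ∈ B.init × R s₁ s₂)

  _≤ₘᴺ_ : Set₁
  _≤ₘᴺ_ = Σ (A.St → B.St → Set) λ R → IsNAARefinement R × NAAInitialised R

_≡ₘᴺ_ : ∀ {k} → NAA k → NAA k → Set₁
A ≡ₘᴺ B = (A ≤ₘᴺ B) × (B ≤ₘᴺ A)

_∨ᴺ_ : ∀ {k} → NAA k → NAA k → NAA k
_∨ᴺ_ {k} A B = record
  { St   = A.St ⊎ B.St
  ; init = map inj₁ A.init ++ map inj₂ B.init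
  ; Tran = tran
  }
  where
    module A = NAA A
    module B = NAA B
    tran : A.St ⊎ B.St → List (Act k (A.St ⊎ B.St)) → Set
    tran (inj₁ s) M = ∃[ M₁ ] (A.Tran s M₁ × M ≡ map (map₂ inj₁) M₁)
    tran (inj₂ s) M = ∃[ M₂ ] (B.Tran s M₂ × M ≡ map (map₂ inj₂) M₂)

_≈ₛ_ : ∀ {A : Set} → List A → List A → Set
L ≈ₛ L' = ∀ x → (x ∈ L) ⇔ (x ∈ L')

_∧ᴺ_ : ∀ {k} → NAA k → NAA k → NAA k
_∧ᴺ_ {k} A B = record
  { St   = A.St × B.St
  ; init = cartesianProduct A.init B.init
  ; Tran = tran
  }
  where
    module A = NAA A
    module B = NAA B
    π₁ : List (Act k (A.St × B.St)) → List (Act k A.St)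
    π₁ = map (λ { (a , (t₁ , t₂)) → (a , t₁) })
    π₂ : List (Act k (A.St × B.St)) → List (Act k B.St)
    π₂ = map (λ { (a , (t₁ , t₂)) → (a , t₂) })
    tran : A.St × B.St → List (Act k (A.St × B.St)) → Set
    tran (s₁ , s₂) M =
      (∃[ M₁ ] (A.Tran s₁ M₁ × M₁ ≈ₛ π₁ M))
      × (∃[ M₂ ] (B.Tran s₂ M₂ × M₂ ≈ₛ π₂ M))

-- Disjunctive modal transition systems (DMTS)
--   may s   : the finite list of may-successors (a , t) of s, i.e.
--             s -a-> t  iff  (a , t) ∈ may s   (image-finite, Σ finite)
--   Must s N: s --> N, where N ⊆ Σ × S; since N is contained in the finite
--             may-image of s, N is finite and given as a list.

record DMTS (k : ℕ) : Set₁ where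
  field
    St       : Set
    init     : List St
    may      : St → List (Act k St)
    Must     : St → List (Act k St) → Set
    must⊆may : ∀ s N → Must s N → ∀ x → x ∈ N → x ∈ may s

module _ {k : ℕ} (A B : DMTS k) where
  private
    module A = DMTS A
    module B = DMTS B

  IsDMTSRefinement : (A.St → B.St → Set) → Set
  IsDMTSRefinement R =
    ∀ s₁ s₂ → R s₁ s₂ →
      (∀ a t₁ → (a , t₁) ∈ A.may s₁ → ∃[ t₂ ] ((a , t₂) ∈ B.may s₂ × R t₁ t₂))
      × (∀ N₂ → B.Must s₂ N₂ → ∃[ N₁ ] (A.Must s₁ N₁
          × (∀ a t₁ → (a , t₁) ∈ N₁ → ∃[ t₂ ] ((a , t₂) ∈ N₂ × R t₁ t₂))))

  DMTSInitialised : (A.St → B.St → Set) → Set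
  DMTSInitialised R = ∀ s₁ → s₁ ∈ A.init → ∃[ s₂ ] (s₂ ∈ B.init × R s₁ s₂)

  _≤ₘᴰ_ : Set₁
  _≤ₘᴰ_ = Σ (A.St → B.St → Set) λ R → IsDMTSRefinement R × DMTSInitialised R

_≡ₘᴰ_ : ∀ {k} → DMTS k → DMTS k → Set₁
A ≡ₘᴰ B = (A ≤ₘᴰ B) × (B ≤ₘᴰ A)

_∨ᴰ_ : ∀ {k} → DMTS k → DMTS k → DMTS k
_∨ᴰ_ {k} A B = record
  { St       = A.St ⊎ B.St
  ; init     = map inj₁ A.init ++ map inj₂ B.init
  ; may      = may
  ; Must     = must
  ; must⊆may = ok
  }
  where
    module A = DMTS A
    module B = DMTS B
    may : A.St ⊎ B.St → List (Act k (A.St ⊎ B.St))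
    may (inj₁ s) = map (map₂ inj₁) (A.may s)
    may (inj₂ s) = map (map₂ inj₂) (B.may s)
    must : A.St ⊎ B.St → List (Act k (A.St ⊎ B.St)) → Set
    must (inj₁ s) N = ∃[ N₁ ] (A.Must s N₁ × N ≡ map (map₂ inj₁) N₁)
    must (inj₂ s) N = ∃[ N₂ ] (B.Must s N₂ × N ≡ map (map₂ inj₂) N₂)
    ok : ∀ s N → must s N → ∀ x → x ∈ N → x ∈ may s
    ok (inj₁ s) N (N₁ , m , refl) x x∈ with ∈-map⁻ (map₂ inj₁) x∈
    ... | y , y∈ , refl = ∈-map⁺ (map₂ inj₁) (A.must⊆may s N₁ m y y∈)
    ok (inj₂ s) N (N₂ , m , refl) x x∈ with ∈-map⁻ (map₂ inj₂) x∈
    ... | y , y∈ , refl = ∈-map⁺ (map₂ inj₂) (B.must⊆may s N₂ m y y∈)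

pairStep : ∀ {k} {S₁ S₂ : Set} → Fin k → S₁ → Act k S₂ → List (Act k (S₁ × S₂))
pairStep a t₁ (b , t₂) with a ≟ b
... | yes _ = (a , (t₁ , t₂)) ∷ []
... | no  _ = []

pairRow : ∀ {k} {S₁ S₂ : Set} → List (Act k S₂) → Act k S₁ → List (Act k (S₁ × S₂))
pairRow L₂ (a , t₁) = concatMap (pairStep a t₁) L₂

pairUp : ∀ {k} {S₁ S₂ : Set} → List (Act k S₁) → List (Act k S₂)
       → List (Act k (S₁ × S₂))
pairUp L₁ L₂ = concatMap (pairRow L₂) L₁

pairStep-∈ : ∀ {k} {S₁ S₂ : Set} (a : Fin k) (t₁ : S₁) (t₂ : S₂)
           → (a , (t₁ , t₂)) ∈ pairStep a t₁ (a , t₂)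
pairStep-∈ a t₁ t₂ with a ≟ a
... | yes _ = here refl
... | no ¬p = ⊥-elim (¬p refl)

pairRow-∈ : ∀ {k} {S₁ S₂ : Set} (L₂ : List (Act k S₂)) {a : Fin k} {t₁ : S₁} {t₂}
          → (a , t₂) ∈ L₂ → (a , (t₁ , t₂)) ∈ pairRow L₂ (a , t₁)
pairRow-∈ L₂ {a} {t₁} {t₂} p = ∈-concatMap⁺ (pairStep a t₁) (go L₂ p)
  where
    go : ∀ L → (a , t₂) ∈ L → Any (λ x → (a , (t₁ , t₂)) ∈ pairStep a t₁ x) L
    go (._ ∷ L) (here refl) = here (pairStep-∈ a t₁ t₂)
    go (_ ∷ L) (there q) = there (go L q)

pairUp-∈ : ∀ {k} {S₁ S₂ : Set} (L₁ : List (Act k S₁)) (L₂ : List (Act k S₂)) {a t₁ t₂}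
         → (a , t₁) ∈ L₁ → (a , t₂) ∈ L₂ → (a , (t₁ , t₂)) ∈ pairUp L₁ L₂
pairUp-∈ L₁ L₂ {a} {t₁} {t₂} p₁ p₂ = ∈-concatMap⁺ (pairRow L₂) (go L₁ p₁)
  where
    go : ∀ L → (a , t₁) ∈ L → Any (λ x → (a , (t₁ , t₂)) ∈ pairRow L₂ x) L
    go (._ ∷ L) (here refl) = here (pairRow-∈ L₂ p₂)
    go (_ ∷ L) (there q) = there (go L q)

_∧ᴰ_ : ∀ {k} → DMTS k → DMTS k → DMTS k
_∧ᴰ_ {k} A B = record
  { St       = A.St × B.St
  ; init     = cartesianProduct A.init B.init
  ; may      = may
  ; Must     = must
  ; must⊆may = ok
  }
  where
    module A = DMTS A
    module B = DMTS B
    may : A.St × B.St → List (Act k (A.St × B.St))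
    may (s₁ , s₂) = pairUp (A.may s₁) (B.may s₂)
    must : A.St × B.St → List (Act k (A.St × B.St)) → Set
    must (s₁ , s₂) N =
      (∃[ N₁ ] (A.Must s₁ N₁ × (∀ a t₁ t₂ → ((a , (t₁ , t₂)) ∈ N)
          ⇔ ((a , t₁) ∈ N₁ × ((a , t₁) ∈ A.may s₁ × (a , t₂) ∈ B.may s₂)))))
      ⊎ (∃[ N₂ ] (B.Must s₂ N₂ × (∀ a t₁ t₂ → ((a , (t₁ , t₂)) ∈ N)
          ⇔ ((a , t₂) ∈ N₂ × ((a , t₁) ∈ A.may s₁ × (a , t₂) ∈ B.may s₂)))))
    ok : ∀ s N → must s N → ∀ x → x ∈ N → x ∈ may s
    ok (s₁ , s₂) N (inj₁ (N₁ , m , e)) (a , (t₁ , t₂)) x∈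
      with Equivalence.to (e a t₁ t₂) x∈
    ... | _ , p₁ , p₂ = pairUp-∈ (A.may s₁) (B.may s₂) p₁ p₂
    ok (s₁ , s₂) N (inj₂ (N₂ , m , e)) (a , (t₁ , t₂)) x∈
      with Equivalence.to (e a t₁ t₂) x∈
    ... | _ , p₁ , p₂ = pairUp-∈ (A.may s₁) (B.may s₂) p₁ p₂

module Submission where

open import Algebra.Core using (Op₂)
open import Data.Empty using (⊥)
open import Data.Fin using (Fin; _≟_)
open import Data.List using (List; []; _∷_; map; _++_; cartesianProduct; allFin)
open import Data.List.Membership.Propositional using (_∈_; find; mapWith∈)
open import Data.List.Membership.Propositional.Properties
  using ( ∈-map⁺; ∈-map⁻; ∈-concatMap⁻; ∈-++⁺ˡ; ∈-++⁺ʳ; ∈-++⁻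
        ; ∈-cartesianProduct⁺; ∈-cartesianProduct⁻; ∈-allFin)
open import Data.List.Relation.Binary.Subset.Propositional using (_⊆_)
open import Data.List.Relation.Unary.Any using (here)
open import Data.List.Relation.Unary.Any.Properties using (mapWith∈⁺)
open import Data.Nat using (ℕ)
open import Data.Product using (Σ; _×_; ∃-syntax; _,_; proj₁; proj₂; map₂; swap)
open import Data.Sum using (_⊎_; inj₁; inj₂)
open import Data.Unit using (⊤; tt)
open import Defs
open import Function.Base using (flip)
open import Function.Bundles using (_⇔_; Equivalence; mk⇔)
open import Level using (0ℓ)
open import Relation.Binary.Construct.Union using (_∪_)
open import Relation.Binary.Core using (REL; Rel)
open import Relation.Binary.Definitions using (Reflexive; Transitive; Maximum; Minimum)
open import Relation.Binary.Lattice.Definitions using (Supremum; Infimum)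
open import Relation.Binary.Lattice.Structures using (IsLattice; IsBoundedLattice; IsDistributiveLattice)
open import Relation.Binary.PropositionalEquality using (_≡_; refl)
open import Relation.Nullary using (yes)

-- Modal refinement is a preorder with ∨ as join, ∧ as meet, a one-state system
-- allowing everything as top and the system without states as bottom; modulo
-- the induced equivalence ≡ₘ this is a bounded lattice, and distributivity
-- reduces to X ∧ (Y ∨ Z) ≤ₘ (X ∧ Y) ∨ (X ∧ Z).  All refinements involved are
-- built from a few basic ones (identity, the injections into Y ∨ Z and their
-- converses, the projections out of A ∧ B, and pairing into it) by composition
-- and union, which preserve being a refinement.  The only step with content
-- beyond bookkeeping is pairing for NAA, where a transition set of A ∧ B must be
-- assembled from jointly matched triples of transitions.

private
  variable
    k : ℕ
    S T U : Set
    R Q : REL S T 0ℓ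

Graph : (S → T) → REL S T 0ℓ
Graph f s t = f s ≡ t

⟨_,_⟩ : REL S T 0ℓ → REL S U 0ℓ → REL S (T × U) 0ℓ
⟨ R , Q ⟩ s (t , u) = R s t × Q s u

_⨾_ : REL S T 0ℓ → REL T U 0ℓ → REL S U 0ℓ
(R ⨾ Q) s u = ∃[ t ] (R s t × Q t u)

-- The initialisation conditions and the refinement conditions of Defs unfold
-- definitionally to statements about _⊆⟨_⟩_, _⊑⟨_⟩_ and _⇄⟨_⟩_.

_⊆⟨_⟩_ : List S → REL S T 0ℓ → List T → Set
xs ⊆⟨ R ⟩ ys = ∀ x → x ∈ xs → ∃[ y ] (y ∈ ys × R x y)

⊆⟨⟩-refl : {xs : List S} → xs ⊆⟨ _≡_ ⟩ xs
⊆⟨⟩-refl x x∈xs = x , x∈xs , refl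

⊆⟨⟩-trans : {xs : List S} {ys : List T} {zs : List U} {Q : REL T U 0ℓ} →
            xs ⊆⟨ R ⟩ ys → ys ⊆⟨ Q ⟩ zs → xs ⊆⟨ R ⨾ Q ⟩ zs
⊆⟨⟩-trans xs⊆ys ys⊆zs x x∈xs with xs⊆ys x x∈xs
... | y , y∈ys , xRy with ys⊆zs y y∈ys
...   | z , z∈zs , yQz = z , z∈zs , y , xRy , yQz

⊆⟨⟩-++-inj₁ : (xs : List S) (ys : List T) → xs ⊆⟨ Graph inj₁ ⟩ (map inj₁ xs ++ map inj₂ ys)
⊆⟨⟩-++-inj₁ xs ys x x∈xs = inj₁ x , ∈-++⁺ˡ (∈-map⁺ inj₁ x∈xs) , refl

⊆⟨⟩-++-inj₂ : (xs : List S) (ys : List T) → ys ⊆⟨ Graph inj₂ ⟩ (map inj₁ xs ++ map inj₂ ys)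
⊆⟨⟩-++-inj₂ xs ys y y∈ys = inj₂ y , ∈-++⁺ʳ (map inj₁ xs) (∈-map⁺ inj₂ y∈ys) , refl

++-⊆⟨⟩ : {xs : List S} {ys : List T} {zs : List U} {R : REL S U 0ℓ} {Q : REL T U 0ℓ} →
         xs ⊆⟨ R ⟩ zs → ys ⊆⟨ Q ⟩ zs →
         (map inj₁ xs ++ map inj₂ ys) ⊆⟨ (flip (Graph inj₁) ⨾ R) ∪ (flip (Graph inj₂) ⨾ Q) ⟩ zs
++-⊆⟨⟩ {xs = xs} xs⊆zs ys⊆zs w w∈ with ∈-++⁻ (map inj₁ xs) w∈
... | inj₁ p with ∈-map⁻ inj₁ p
...   | x , x∈xs , refl with xs⊆zs x x∈xs
...     | z , z∈zs , xRz = z , z∈zs , inj₁ (x , refl , xRz)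
++-⊆⟨⟩ xs⊆zs ys⊆zs w w∈ | inj₂ p with ∈-map⁻ inj₂ p
...   | y , y∈ys , refl with ys⊆zs y y∈ys
...     | z , z∈zs , yQz = z , z∈zs , inj₂ (y , refl , yQz)

cartesianProduct-⊆⟨⟩-proj₁ : (xs : List S) (ys : List T) → cartesianProduct xs ys ⊆⟨ Graph proj₁ ⟩ xs
cartesianProduct-⊆⟨⟩-proj₁ xs ys (x , y) p = x , proj₁ (∈-cartesianProduct⁻ xs ys p) , refl

cartesianProduct-⊆⟨⟩-proj₂ : (xs : List S) (ys : List T) → cartesianProduct xs ys ⊆⟨ Graph proj₂ ⟩ ys
cartesianProduct-⊆⟨⟩-proj₂ xs ys (x , y) p = y , proj₂ (∈-cartesianProduct⁻ xs ys p) , refl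

⊆⟨⟩-cartesianProduct : {xs : List S} {ys : List T} {zs : List U} {Q : REL S U 0ℓ} →
                       xs ⊆⟨ R ⟩ ys → xs ⊆⟨ Q ⟩ zs → xs ⊆⟨ ⟨ R , Q ⟩ ⟩ cartesianProduct ys zs
⊆⟨⟩-cartesianProduct xs⊆ys xs⊆zs x x∈xs with xs⊆ys x x∈xs | xs⊆zs x x∈xs
... | y , y∈ys , xRy | z , z∈zs , xQz = (y , z) , ∈-cartesianProduct⁺ y∈ys z∈zs , xRy , xQz

-- Relates (s , inj₁ t) to inj₁ (s , t) and (s , inj₂ u) to inj₂ (s , u).
Distrib : REL (S × (T ⊎ U)) ((S × T) ⊎ (S × U)) 0ℓ
Distrib = (⟨ Graph proj₁ , Graph proj₂ ⨾ flip (Graph inj₁) ⟩ ⨾ Graph inj₁)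
        ∪ (⟨ Graph proj₁ , Graph proj₂ ⨾ flip (Graph inj₂) ⟩ ⨾ Graph inj₂)

cartesianProduct-++-⊆⟨Distrib⟩ : (xs : List S) (ys : List T) (zs : List U) →
  cartesianProduct xs (map inj₁ ys ++ map inj₂ zs)
    ⊆⟨ Distrib ⟩ (map inj₁ (cartesianProduct xs ys) ++ map inj₂ (cartesianProduct xs zs))
cartesianProduct-++-⊆⟨Distrib⟩ xs ys zs (x , w) p
  with ∈-cartesianProduct⁻ xs (map inj₁ ys ++ map inj₂ zs) p
... | x∈xs , w∈ with ∈-++⁻ (map inj₁ ys) w∈
...   | inj₁ q with ∈-map⁻ inj₁ q
...     | y , y∈ys , refl =
  inj₁ (x , y) , ∈-++⁺ˡ (∈-map⁺ inj₁ (∈-cartesianProduct⁺ x∈xs y∈ys)) ,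
  inj₁ ((x , y) , (refl , w , refl , refl) , refl)
cartesianProduct-++-⊆⟨Distrib⟩ xs ys zs (x , w) p | x∈xs , w∈ | inj₂ q with ∈-map⁻ inj₂ q
...     | z , z∈zs , refl =
  inj₂ (x , z) ,
  ∈-++⁺ʳ (map inj₁ (cartesianProduct xs ys)) (∈-map⁺ inj₂ (∈-cartesianProduct⁺ x∈xs z∈zs)) ,
  inj₂ ((x , z) , (refl , w , refl , refl) , refl)

_⊑⟨_⟩_ : List (Act k S) → REL S T 0ℓ → List (Act k T) → Set
L₁ ⊑⟨ R ⟩ L₂ = ∀ a t₁ → (a , t₁) ∈ L₁ → ∃[ t₂ ] ((a , t₂) ∈ L₂ × R t₁ t₂)

_⇄⟨_⟩_ : List (Act k S) → REL S T 0ℓ → List (Act k T) → Set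
L₁ ⇄⟨ R ⟩ L₂ = L₁ ⊑⟨ R ⟩ L₂ × L₂ ⊑⟨ flip R ⟩ L₁

⊑-refl : {L : List (Act k S)} → L ⊑⟨ _≡_ ⟩ L
⊑-refl a t t∈L = t , t∈L , refl

⊑-trans : {L₁ : List (Act k S)} {L₂ : List (Act k T)} {L₃ : List (Act k U)} {Q : REL T U 0ℓ} →
          L₁ ⊑⟨ R ⟩ L₂ → L₂ ⊑⟨ Q ⟩ L₃ → L₁ ⊑⟨ R ⨾ Q ⟩ L₃
⊑-trans L₁⊑L₂ L₂⊑L₃ a t₁ t₁∈L₁ with L₁⊑L₂ a t₁ t₁∈L₁
... | t₂ , t₂∈L₂ , t₁Rt₂ with L₂⊑L₃ a t₂ t₂∈L₂
...   | t₃ , t₃∈L₃ , t₂Qt₃ = t₃ , t₃∈L₃ , t₂ , t₁Rt₂ , t₂Qt₃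

⊑-mono : {L₁ : List (Act k S)} {L₂ : List (Act k T)} →
         (∀ {s t} → R s t → Q s t) → L₁ ⊑⟨ R ⟩ L₂ → L₁ ⊑⟨ Q ⟩ L₂
⊑-mono R⇒Q L₁⊑L₂ a t₁ t₁∈L₁ with L₁⊑L₂ a t₁ t₁∈L₁
... | t₂ , t₂∈L₂ , t₁Rt₂ = t₂ , t₂∈L₂ , R⇒Q t₁Rt₂

⊑-⊆ˡ : {L₀ L₁ : List (Act k S)} {L₂ : List (Act k T)} → L₀ ⊆ L₁ → L₁ ⊑⟨ R ⟩ L₂ → L₀ ⊑⟨ R ⟩ L₂
⊑-⊆ˡ L₀⊆L₁ L₁⊑L₂ a t t∈L₀ = L₁⊑L₂ a t (L₀⊆L₁ t∈L₀)

⊑-⊆ʳ : {L₁ : List (Act k S)} {L₂ L₃ : List (Act k T)} → L₁ ⊑⟨ R ⟩ L₂ → L₂ ⊆ L₃ → L₁ ⊑⟨ R ⟩ L₃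
⊑-⊆ʳ L₁⊑L₂ L₂⊆L₃ a t t∈L₁ with L₁⊑L₂ a t t∈L₁
... | t₂ , t₂∈L₂ , tRt₂ = t₂ , L₂⊆L₃ t₂∈L₂ , tRt₂

⊑-map : {L : List (Act k S)} (f : S → T) → L ⊑⟨ Graph f ⟩ map (map₂ f) L
⊑-map f a t t∈L = f t , ∈-map⁺ (map₂ f) t∈L , refl

⊑-map⁻ : {L : List (Act k S)} (f : S → T) → map (map₂ f) L ⊑⟨ flip (Graph f) ⟩ L
⊑-map⁻ f a t t∈fL with ∈-map⁻ (map₂ f) t∈fL
... | (_ , s) , s∈L , refl = s , s∈L , refl

⊑-fanout : {L : List (Act k S)} {L₁ : List (Act k T)} {L₂ : List (Act k U)}
           {N : List (Act k (T × U))} {Q : REL S U 0ℓ} →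
           L ⊑⟨ R ⟩ L₁ → L ⊑⟨ Q ⟩ L₂ →
           (∀ a t₁ t₂ → (a , t₁) ∈ L₁ → (a , t₂) ∈ L₂ → (a , (t₁ , t₂)) ∈ N) →
           L ⊑⟨ ⟨ R , Q ⟩ ⟩ N
⊑-fanout L⊑L₁ L⊑L₂ pairs∈N a s s∈L with L⊑L₁ a s s∈L | L⊑L₂ a s s∈L
... | t₁ , t₁∈L₁ , sRt₁ | t₂ , t₂∈L₂ , sQt₂ = (t₁ , t₂) , pairs∈N a t₁ t₂ t₁∈L₁ t₂∈L₂ , sRt₁ , sQt₂

⇄-refl : {L : List (Act k S)} → L ⇄⟨ _≡_ ⟩ L
⇄-refl = ⊑-refl , λ a t t∈L → t , t∈L , refl

⇄-sym : {L₁ : List (Act k S)} {L₂ : List (Act k T)} → L₁ ⇄⟨ R ⟩ L₂ → L₂ ⇄⟨ flip R ⟩ L₁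
⇄-sym = swap

⇄-trans : {L₁ : List (Act k S)} {L₂ : List (Act k T)} {L₃ : List (Act k U)} {Q : REL T U 0ℓ} →
          L₁ ⇄⟨ R ⟩ L₂ → L₂ ⇄⟨ Q ⟩ L₃ → L₁ ⇄⟨ R ⨾ Q ⟩ L₃
⇄-trans (L₁⊑L₂ , L₂⊒L₁) (L₂⊑L₃ , L₃⊒L₂) =
  ⊑-trans L₁⊑L₂ L₂⊑L₃ , ⊑-mono (λ (t₂ , r , q) → t₂ , q , r) (⊑-trans L₃⊒L₂ L₂⊒L₁)

⇄-mono : {L₁ : List (Act k S)} {L₂ : List (Act k T)} →
         (∀ {s t} → R s t → Q s t) → L₁ ⇄⟨ R ⟩ L₂ → L₁ ⇄⟨ Q ⟩ L₂
⇄-mono R⇒Q (L₁⊑L₂ , L₂⊒L₁) = ⊑-mono R⇒Q L₁⊑L₂ , ⊑-mono R⇒Q L₂⊒L₁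

⇄-map : {L : List (Act k S)} (f : S → T) → L ⇄⟨ Graph f ⟩ map (map₂ f) L
⇄-map f = ⊑-map f , ⊑-map⁻ f

⇄-≈ₛ : {L₁ : List (Act k S)} {L₂ L₃ : List (Act k T)} → L₁ ⇄⟨ R ⟩ L₂ → L₃ ≈ₛ L₂ → L₁ ⇄⟨ R ⟩ L₃
⇄-≈ₛ (L₁⊑L₂ , L₂⊒L₁) L₃≈L₂ =
  ⊑-⊆ʳ L₁⊑L₂ (Equivalence.from (L₃≈L₂ _)) , ⊑-⊆ˡ (Equivalence.to (L₃≈L₂ _)) L₂⊒L₁

∈-pairStep⁻ : ∀ {a b : Fin k} {t₁ : S} {t₂ : T} {x} →
              x ∈ pairStep a t₁ (b , t₂) → x ≡ (a , (t₁ , t₂)) × a ≡ b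
∈-pairStep⁻ {a = a} {b} p with a ≟ b
∈-pairStep⁻ (here refl) | yes refl = refl , refl

∈-pairUp⁻ : (L₁ : List (Act k S)) (L₂ : List (Act k T)) {a : Fin k} {t₁ : S} {t₂ : T} →
            (a , (t₁ , t₂)) ∈ pairUp L₁ L₂ → (a , t₁) ∈ L₁ × (a , t₂) ∈ L₂
∈-pairUp⁻ L₁ L₂ p with find (∈-concatMap⁻ (pairRow L₂) {xs = L₁} p)
... | (a , t₁) , t₁∈L₁ , q with find (∈-concatMap⁻ (pairStep a t₁) {xs = L₂} q)
...   | (b , t₂) , t₂∈L₂ , r with ∈-pairStep⁻ r
...     | refl , refl = t₁∈L₁ , t₂∈L₂

pairUp-⊑-proj₁ : (L₁ : List (Act k S)) (L₂ : List (Act k T)) → pairUp L₁ L₂ ⊑⟨ Graph proj₁ ⟩ L₁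
pairUp-⊑-proj₁ L₁ L₂ a (t₁ , t₂) p = t₁ , proj₁ (∈-pairUp⁻ L₁ L₂ p) , refl

pairUp-⊑-proj₂ : (L₁ : List (Act k S)) (L₂ : List (Act k T)) → pairUp L₁ L₂ ⊑⟨ Graph proj₂ ⟩ L₂
pairUp-⊑-proj₂ L₁ L₂ a (t₁ , t₂) p = t₂ , proj₂ (∈-pairUp⁻ L₁ L₂ p) , refl

∈-mapWith∈ : {xs : List S} (f : ∀ {x} → x ∈ xs → T) {x : S} (x∈xs : x ∈ xs) → f x∈xs ∈ mapWith∈ xs f
∈-mapWith∈ f x∈xs = mapWith∈⁺ f (_ , x∈xs , refl)

module JointMatching {M : List (Act k S)} {M₁ : List (Act k T)} {M₂ : List (Act k U)}
  {R₁ : REL S T 0ℓ} {R₂ : REL S U 0ℓ} (M⇄M₁ : M ⇄⟨ R₁ ⟩ M₁) (M⇄M₂ : M ⇄⟨ R₂ ⟩ M₂) where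

  -- M₁₂ has one jointly matched triple for each element of M, M₁ and M₂, so
  -- that both of its projections are onto.
  record Joint : Set where
    constructor joint
    field
      label    : Fin k
      {src}    : S
      {tgt₁}   : T
      {tgt₂}   : U
      src∈M    : (label , src) ∈ M
      tgt₁∈M₁  : (label , tgt₁) ∈ M₁
      tgt₂∈M₂  : (label , tgt₂) ∈ M₂
      related₁ : R₁ src tgt₁
      related₂ : R₂ src tgt₂

  open Joint

  edge : Joint → Act k (T × U)
  edge j = label j , (tgt₁ j , tgt₂ j)

  fromM : ∀ {x} → x ∈ M → Joint
  fromM {a , s} s∈M =
    let t₁ , t₁∈M₁ , r₁ = proj₁ M⇄M₁ a s s∈M
        t₂ , t₂∈M₂ , r₂ = proj₁ M⇄M₂ a s s∈M
    in joint a s∈M t₁∈M₁ t₂∈M₂ r₁ r₂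

  fromM₁ : ∀ {x} → x ∈ M₁ → Joint
  fromM₁ {a , t₁} t₁∈M₁ =
    let s , s∈M , r₁ = proj₂ M⇄M₁ a t₁ t₁∈M₁
        t₂ , t₂∈M₂ , r₂ = proj₁ M⇄M₂ a s s∈M
    in joint a s∈M t₁∈M₁ t₂∈M₂ r₁ r₂

  fromM₂ : ∀ {x} → x ∈ M₂ → Joint
  fromM₂ {a , t₂} t₂∈M₂ =
    let s , s∈M , r₂ = proj₂ M⇄M₂ a t₂ t₂∈M₂
        t₁ , t₁∈M₁ , r₁ = proj₁ M⇄M₁ a s s∈M
    in joint a s∈M t₁∈M₁ t₂∈M₂ r₁ r₂

  joints : List Joint
  joints = mapWith∈ M fromM ++ mapWith∈ M₁ fromM₁ ++ mapWith∈ M₂ fromM₂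

  M₁₂ : List (Act k (T × U))
  M₁₂ = map edge joints

  fromM-∈ : ∀ {x} (x∈M : x ∈ M) → edge (fromM x∈M) ∈ M₁₂
  fromM-∈ x∈M = ∈-map⁺ edge (∈-++⁺ˡ (∈-mapWith∈ fromM x∈M))

  fromM₁-∈ : ∀ {x} (x∈M₁ : x ∈ M₁) → edge (fromM₁ x∈M₁) ∈ M₁₂
  fromM₁-∈ x∈M₁ = ∈-map⁺ edge (∈-++⁺ʳ (mapWith∈ M fromM) (∈-++⁺ˡ (∈-mapWith∈ fromM₁ x∈M₁)))

  fromM₂-∈ : ∀ {x} (x∈M₂ : x ∈ M₂) → edge (fromM₂ x∈M₂) ∈ M₁₂
  fromM₂-∈ x∈M₂ =
    ∈-map⁺ edge (∈-++⁺ʳ (mapWith∈ M fromM) (∈-++⁺ʳ (mapWith∈ M₁ fromM₁) (∈-mapWith∈ fromM₂ x∈M₂)))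

  M₁≈π₁M₁₂ : M₁ ≈ₛ map (map₂ proj₁) M₁₂
  M₁≈π₁M₁₂ x = mk⇔ (λ x∈M₁ → ∈-map⁺ (map₂ proj₁) (fromM₁-∈ x∈M₁)) from
    where
      from : x ∈ map (map₂ proj₁) M₁₂ → x ∈ M₁
      from p with ∈-map⁻ (map₂ proj₁) p
      ... | _ , q , refl with ∈-map⁻ edge q
      ...   | j , _ , refl = tgt₁∈M₁ j

  M₂≈π₂M₁₂ : M₂ ≈ₛ map (map₂ proj₂) M₁₂
  M₂≈π₂M₁₂ x = mk⇔ (λ x∈M₂ → ∈-map⁺ (map₂ proj₂) (fromM₂-∈ x∈M₂)) from
    where
      from : x ∈ map (map₂ proj₂) M₁₂ → x ∈ M₂
      from p with ∈-map⁻ (map₂ proj₂) p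
      ... | _ , q , refl with ∈-map⁻ edge q
      ...   | j , _ , refl = tgt₂∈M₂ j

  M⇄M₁₂ : M ⇄⟨ ⟨ R₁ , R₂ ⟩ ⟩ M₁₂
  M⇄M₁₂ = (λ a s s∈M → _ , fromM-∈ s∈M , related₁ (fromM s∈M) , related₂ (fromM s∈M)) , backward
    where
      backward : M₁₂ ⊑⟨ flip ⟨ R₁ , R₂ ⟩ ⟩ M
      backward a t t∈M₁₂ with ∈-map⁻ edge t∈M₁₂
      ... | j , _ , refl = src j , src∈M j , related₁ j , related₂ j

module _ {a ℓ} {A : Set a} {_≤_ : Rel A ℓ} {_∨_ _∧_ : Op₂ A} {top bot : A} where

  private
    _≈_ : Rel A ℓ
    x ≈ y = x ≤ y × y ≤ x

  boundedDistributiveLattice :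
    Reflexive _≤_ → Transitive _≤_ → Supremum _≤_ _∨_ → Infimum _≤_ _∧_ →
    Maximum _≤_ top → Minimum _≤_ bot →
    (∀ x y z → (x ∧ (y ∨ z)) ≤ ((x ∧ y) ∨ (x ∧ z))) →
    IsBoundedLattice _≈_ _≤_ _∨_ _∧_ top bot × IsDistributiveLattice _≈_ _≤_ _∨_ _∧_
  boundedDistributiveLattice ≤-refl ≤-trans sup inf max min distrib-≤ =
    record { isLattice = isLattice ; maximum = max ; minimum = min } ,
    record { isLattice = isLattice ; ∧-distribˡ-∨ = λ x y z → distrib-≤ x y z , distrib-≥ x y z }
    where
      isLattice : IsLattice _≈_ _≤_ _∨_ _∧_
      isLattice = record
        { isPartialOrder = record
          { isPreorder = record
            { isEquivalence = record
              { refl = ≤-refl , ≤-refl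
              ; sym = swap
              ; trans = λ (x≤y , y≤x) (y≤z , z≤y) → ≤-trans x≤y y≤z , ≤-trans z≤y y≤x }
            ; reflexive = proj₁
            ; trans = ≤-trans }
          ; antisym = _,_ }
        ; supremum = sup
        ; infimum = inf }

      ∧-monoʳ : ∀ x {y w} → y ≤ w → (x ∧ y) ≤ (x ∧ w)
      ∧-monoʳ x {y} {w} y≤w =
        let x∧y≤x , x∧y≤y , _ = inf x y
            _ , _ , ∧-greatest = inf x w
        in ∧-greatest (x ∧ y) x∧y≤x (≤-trans x∧y≤y y≤w)

      distrib-≥ : ∀ x y z → ((x ∧ y) ∨ (x ∧ z)) ≤ (x ∧ (y ∨ z))
      distrib-≥ x y z =
        let y≤y∨z , z≤y∨z , _ = sup y z
            _ , _ , ∨-least = sup (x ∧ y) (x ∧ z)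
        in ∨-least (x ∧ (y ∨ z)) (∧-monoʳ x y≤y∨z) (∧-monoʳ x z≤y∨z)

module NAALattice {k : ℕ} where
  open NAA

  ≡-isRefinement : (A : NAA k) → IsNAARefinement A A _≡_
  ≡-isRefinement A s .s refl M tr = M , tr , ⇄-refl

  ⨾-isRefinement : (A B C : NAA k) {R : REL (St A) (St B) 0ℓ} {Q : REL (St B) (St C) 0ℓ} →
                   IsNAARefinement A B R → IsNAARefinement B C Q → IsNAARefinement A C (R ⨾ Q)
  ⨾-isRefinement A B C R-ref Q-ref s u (t , sRt , tQu) M₁ tr₁ with R-ref s t sRt M₁ tr₁
  ... | M₂ , tr₂ , M₁⇄M₂ with Q-ref t u tQu M₂ tr₂
  ...   | M₃ , tr₃ , M₂⇄M₃ = M₃ , tr₃ , ⇄-trans M₁⇄M₂ M₂⇄M₃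

  ∪-isRefinement : (A B : NAA k) {R Q : REL (St A) (St B) 0ℓ} →
                   IsNAARefinement A B R → IsNAARefinement A B Q → IsNAARefinement A B (R ∪ Q)
  ∪-isRefinement A B R-ref Q-ref s t (inj₁ sRt) M₁ tr₁ with R-ref s t sRt M₁ tr₁
  ... | M₂ , tr₂ , M₁⇄M₂ = M₂ , tr₂ , ⇄-mono inj₁ M₁⇄M₂
  ∪-isRefinement A B R-ref Q-ref s t (inj₂ sQt) M₁ tr₁ with Q-ref s t sQt M₁ tr₁
  ... | M₂ , tr₂ , M₁⇄M₂ = M₂ , tr₂ , ⇄-mono inj₂ M₁⇄M₂

  inj₁-isRefinement : (A B : NAA k) → IsNAARefinement A (A ∨ᴺ B) (Graph inj₁)
  inj₁-isRefinement A B s .(inj₁ s) refl M tr = map (map₂ inj₁) M , (M , tr , refl) , ⇄-map inj₁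

  inj₂-isRefinement : (A B : NAA k) → IsNAARefinement B (A ∨ᴺ B) (Graph inj₂)
  inj₂-isRefinement A B s .(inj₂ s) refl M tr = map (map₂ inj₂) M , (M , tr , refl) , ⇄-map inj₂

  inj₁⁻¹-isRefinement : (A B : NAA k) → IsNAARefinement (A ∨ᴺ B) A (flip (Graph inj₁))
  inj₁⁻¹-isRefinement A B .(inj₁ s) s refl _ (M , tr , refl) = M , tr , ⇄-sym (⇄-map inj₁)

  inj₂⁻¹-isRefinement : (A B : NAA k) → IsNAARefinement (A ∨ᴺ B) B (flip (Graph inj₂))
  inj₂⁻¹-isRefinement A B .(inj₂ s) s refl _ (M , tr , refl) = M , tr , ⇄-sym (⇄-map inj₂)

  proj₁-isRefinement : (A B : NAA k) → IsNAARefinement (A ∧ᴺ B) A (Graph proj₁)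
  proj₁-isRefinement A B (s₁ , s₂) .s₁ refl M ((M₁ , tr₁ , M₁≈π₁M) , _) =
    M₁ , tr₁ , ⇄-≈ₛ (⇄-map proj₁) M₁≈π₁M

  proj₂-isRefinement : (A B : NAA k) → IsNAARefinement (A ∧ᴺ B) B (Graph proj₂)
  proj₂-isRefinement A B (s₁ , s₂) .s₂ refl M (_ , (M₂ , tr₂ , M₂≈π₂M)) =
    M₂ , tr₂ , ⇄-≈ₛ (⇄-map proj₂) M₂≈π₂M

  fanout-isRefinement : (X A B : NAA k) {R : REL (St X) (St A) 0ℓ} {Q : REL (St X) (St B) 0ℓ} →
    IsNAARefinement X A R → IsNAARefinement X B Q → IsNAARefinement X (A ∧ᴺ B) ⟨ R , Q ⟩
  fanout-isRefinement X A B R-ref Q-ref s (t , u) (sRt , sQu) M tr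
    with R-ref s t sRt M tr | Q-ref s u sQu M tr
  ... | M₁ , tr₁ , M⇄M₁ | M₂ , tr₂ , M⇄M₂ =
    M₁₂ , ((M₁ , tr₁ , M₁≈π₁M₁₂) , (M₂ , tr₂ , M₂≈π₂M₁₂)) , M⇄M₁₂
    where open JointMatching M⇄M₁ M⇄M₂

  ∧-monoʳ-isRefinement : (X A B : NAA k) {R : REL (St A) (St B) 0ℓ} → IsNAARefinement A B R →
    IsNAARefinement (X ∧ᴺ A) (X ∧ᴺ B) ⟨ Graph proj₁ , Graph proj₂ ⨾ R ⟩
  ∧-monoʳ-isRefinement X A B R-ref =
    fanout-isRefinement (X ∧ᴺ A) X B (proj₁-isRefinement X A)
      (⨾-isRefinement (X ∧ᴺ A) A B (proj₂-isRefinement X A) R-ref)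

  ⊤ᴺ : NAA k
  ⊤ᴺ = record { St = ⊤ ; init = tt ∷ [] ; Tran = λ _ _ → ⊤ }

  ⊥ᴺ : NAA k
  ⊥ᴺ = record { St = ⊥ ; init = [] ; Tran = λ _ _ → ⊤ }

  ≤-refl : (A : NAA k) → A ≤ₘᴺ A
  ≤-refl A = _≡_ , ≡-isRefinement A , ⊆⟨⟩-refl

  ≤-trans : (A B C : NAA k) → A ≤ₘᴺ B → B ≤ₘᴺ C → A ≤ₘᴺ C
  ≤-trans A B C (R , R-ref , R-init) (Q , Q-ref , Q-init) =
    R ⨾ Q , ⨾-isRefinement A B C R-ref Q-ref , ⊆⟨⟩-trans R-init Q-init

  ∨-supremum : Supremum (_≤ₘᴺ_ {k}) _∨ᴺ_
  ∨-supremum A B =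
    (Graph inj₁ , inj₁-isRefinement A B , ⊆⟨⟩-++-inj₁ (init A) (init B)) ,
    (Graph inj₂ , inj₂-isRefinement A B , ⊆⟨⟩-++-inj₂ (init A) (init B)) ,
    λ C (R , R-ref , R-init) (Q , Q-ref , Q-init) →
      _ , ∪-isRefinement (A ∨ᴺ B) C (⨾-isRefinement (A ∨ᴺ B) A C (inj₁⁻¹-isRefinement A B) R-ref)
                                    (⨾-isRefinement (A ∨ᴺ B) B C (inj₂⁻¹-isRefinement A B) Q-ref)
        , ++-⊆⟨⟩ R-init Q-init

  ∧-infimum : Infimum (_≤ₘᴺ_ {k}) _∧ᴺ_
  ∧-infimum A B =
    (Graph proj₁ , proj₁-isRefinement A B , cartesianProduct-⊆⟨⟩-proj₁ (init A) (init B)) ,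
    (Graph proj₂ , proj₂-isRefinement A B , cartesianProduct-⊆⟨⟩-proj₂ (init A) (init B)) ,
    λ X (R , R-ref , R-init) (Q , Q-ref , Q-init) →
      ⟨ R , Q ⟩ , fanout-isRefinement X A B R-ref Q-ref , ⊆⟨⟩-cartesianProduct R-init Q-init

  ≤-⊤ : (A : NAA k) → A ≤ₘᴺ ⊤ᴺ
  ≤-⊤ A = Graph (λ _ → tt) , isRefinement , λ s _ → tt , here refl , refl
    where
      isRefinement : IsNAARefinement A ⊤ᴺ (Graph (λ _ → tt))
      isRefinement s tt refl M _ = map (map₂ (λ _ → tt)) M , tt , ⇄-map (λ _ → tt)

  ⊥-≤ : (A : NAA k) → ⊥ᴺ ≤ₘᴺ A
  ⊥-≤ A = (λ ()) , (λ ()) , λ _ ()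

  ∧-distribˡ-∨-≤ : (X Y Z : NAA k) → (X ∧ᴺ (Y ∨ᴺ Z)) ≤ₘᴺ ((X ∧ᴺ Y) ∨ᴺ (X ∧ᴺ Z))
  ∧-distribˡ-∨-≤ X Y Z =
    Distrib , ∪-isRefinement X∧[Y∨Z] [X∧Y]∨[X∧Z] viaY viaZ ,
    cartesianProduct-++-⊆⟨Distrib⟩ (init X) (init Y) (init Z)
    where
      X∧[Y∨Z] [X∧Y]∨[X∧Z] : NAA k
      X∧[Y∨Z] = X ∧ᴺ (Y ∨ᴺ Z)
      [X∧Y]∨[X∧Z] = (X ∧ᴺ Y) ∨ᴺ (X ∧ᴺ Z)

      viaY : IsNAARefinement X∧[Y∨Z] [X∧Y]∨[X∧Z]
               (⟨ Graph proj₁ , Graph proj₂ ⨾ flip (Graph inj₁) ⟩ ⨾ Graph inj₁)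
      viaY = ⨾-isRefinement X∧[Y∨Z] (X ∧ᴺ Y) [X∧Y]∨[X∧Z]
        (∧-monoʳ-isRefinement X (Y ∨ᴺ Z) Y (inj₁⁻¹-isRefinement Y Z))
        (inj₁-isRefinement (X ∧ᴺ Y) (X ∧ᴺ Z))

      viaZ : IsNAARefinement X∧[Y∨Z] [X∧Y]∨[X∧Z]
               (⟨ Graph proj₁ , Graph proj₂ ⨾ flip (Graph inj₂) ⟩ ⨾ Graph inj₂)
      viaZ = ⨾-isRefinement X∧[Y∨Z] (X ∧ᴺ Z) [X∧Y]∨[X∧Z]
        (∧-monoʳ-isRefinement X (Y ∨ᴺ Z) Z (inj₂⁻¹-isRefinement Y Z))
        (inj₂-isRefinement (X ∧ᴺ Y) (X ∧ᴺ Z))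

  isBoundedDistributiveLattice :
    IsBoundedLattice (_≡ₘᴺ_ {k}) _≤ₘᴺ_ _∨ᴺ_ _∧ᴺ_ ⊤ᴺ ⊥ᴺ
    × IsDistributiveLattice (_≡ₘᴺ_ {k}) _≤ₘᴺ_ _∨ᴺ_ _∧ᴺ_
  isBoundedDistributiveLattice =
    boundedDistributiveLattice (λ {A} → ≤-refl A) (λ {A} {B} {C} → ≤-trans A B C)
      ∨-supremum ∧-infimum ≤-⊤ ⊥-≤ ∧-distribˡ-∨-≤

module DMTSLattice {k : ℕ} where
  open DMTS

  ≡-isRefinement : (A : DMTS k) → IsDMTSRefinement A A _≡_
  ≡-isRefinement A s .s refl = ⊑-refl , λ N m → N , m , ⊑-refl

  ⨾-isRefinement : (A B C : DMTS k) {R : REL (St A) (St B) 0ℓ} {Q : REL (St B) (St C) 0ℓ} →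
                   IsDMTSRefinement A B R → IsDMTSRefinement B C Q → IsDMTSRefinement A C (R ⨾ Q)
  ⨾-isRefinement A B C {R} {Q} R-ref Q-ref s u (t , sRt , tQu) =
    ⊑-trans (proj₁ (R-ref s t sRt)) (proj₁ (Q-ref t u tQu)) , must
    where
      must : ∀ N₃ → Must C u N₃ → ∃[ N₁ ] (Must A s N₁ × N₁ ⊑⟨ R ⨾ Q ⟩ N₃)
      must N₃ m₃ with proj₂ (Q-ref t u tQu) N₃ m₃
      ... | N₂ , m₂ , N₂⊑N₃ with proj₂ (R-ref s t sRt) N₂ m₂
      ...   | N₁ , m₁ , N₁⊑N₂ = N₁ , m₁ , ⊑-trans N₁⊑N₂ N₂⊑N₃

  ∪-isRefinement : (A B : DMTS k) {R Q : REL (St A) (St B) 0ℓ} →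
                   IsDMTSRefinement A B R → IsDMTSRefinement A B Q → IsDMTSRefinement A B (R ∪ Q)
  ∪-isRefinement A B R-ref Q-ref s t (inj₁ sRt) =
    let may-⊑ , must-⊒ = R-ref s t sRt
    in ⊑-mono inj₁ may-⊑ , λ N₂ m₂ → let N₁ , m₁ , N₁⊑N₂ = must-⊒ N₂ m₂ in N₁ , m₁ , ⊑-mono inj₁ N₁⊑N₂
  ∪-isRefinement A B R-ref Q-ref s t (inj₂ sQt) =
    let may-⊑ , must-⊒ = Q-ref s t sQt
    in ⊑-mono inj₂ may-⊑ , λ N₂ m₂ → let N₁ , m₁ , N₁⊑N₂ = must-⊒ N₂ m₂ in N₁ , m₁ , ⊑-mono inj₂ N₁⊑N₂

  inj₁-isRefinement : (A B : DMTS k) → IsDMTSRefinement A (A ∨ᴰ B) (Graph inj₁)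
  inj₁-isRefinement A B s .(inj₁ s) refl = ⊑-map inj₁ , λ { _ (N , m , refl) → N , m , ⊑-map inj₁ }

  inj₂-isRefinement : (A B : DMTS k) → IsDMTSRefinement B (A ∨ᴰ B) (Graph inj₂)
  inj₂-isRefinement A B s .(inj₂ s) refl = ⊑-map inj₂ , λ { _ (N , m , refl) → N , m , ⊑-map inj₂ }

  inj₁⁻¹-isRefinement : (A B : DMTS k) → IsDMTSRefinement (A ∨ᴰ B) A (flip (Graph inj₁))
  inj₁⁻¹-isRefinement A B .(inj₁ s) s refl =
    ⊑-map⁻ inj₁ , λ N m → map (map₂ inj₁) N , (N , m , refl) , ⊑-map⁻ inj₁

  inj₂⁻¹-isRefinement : (A B : DMTS k) → IsDMTSRefinement (A ∨ᴰ B) B (flip (Graph inj₂))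
  inj₂⁻¹-isRefinement A B .(inj₂ s) s refl =
    ⊑-map⁻ inj₂ , λ N m → map (map₂ inj₂) N , (N , m , refl) , ⊑-map⁻ inj₂

  proj₁-isRefinement : (A B : DMTS k) → IsDMTSRefinement (A ∧ᴰ B) A (Graph proj₁)
  proj₁-isRefinement A B (s₁ , s₂) .s₁ refl =
    pairUp-⊑-proj₁ (may A s₁) (may B s₂) ,
    λ N₁ m → pairUp N₁ (may B s₂) , inj₁ (N₁ , m , members m) , pairUp-⊑-proj₁ N₁ (may B s₂)
    where
      members : ∀ {N₁} → Must A s₁ N₁ → ∀ a t₁ t₂ →
        (a , (t₁ , t₂)) ∈ pairUp N₁ (may B s₂)
          ⇔ ((a , t₁) ∈ N₁ × (a , t₁) ∈ may A s₁ × (a , t₂) ∈ may B s₂)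
      members {N₁} m a t₁ t₂ = mk⇔
        (λ p → let t₁∈N₁ , t₂∈may = ∈-pairUp⁻ N₁ (may B s₂) p
               in t₁∈N₁ , must⊆may A s₁ N₁ m _ t₁∈N₁ , t₂∈may)
        (λ (t₁∈N₁ , _ , t₂∈may) → pairUp-∈ N₁ (may B s₂) t₁∈N₁ t₂∈may)

  proj₂-isRefinement : (A B : DMTS k) → IsDMTSRefinement (A ∧ᴰ B) B (Graph proj₂)
  proj₂-isRefinement A B (s₁ , s₂) .s₂ refl =
    pairUp-⊑-proj₂ (may A s₁) (may B s₂) ,
    λ N₂ m → pairUp (may A s₁) N₂ , inj₂ (N₂ , m , members m) , pairUp-⊑-proj₂ (may A s₁) N₂
    where
      members : ∀ {N₂} → Must B s₂ N₂ → ∀ a t₁ t₂ →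
        (a , (t₁ , t₂)) ∈ pairUp (may A s₁) N₂
          ⇔ ((a , t₂) ∈ N₂ × (a , t₁) ∈ may A s₁ × (a , t₂) ∈ may B s₂)
      members {N₂} m a t₁ t₂ = mk⇔
        (λ p → let t₁∈may , t₂∈N₂ = ∈-pairUp⁻ (may A s₁) N₂ p
               in t₂∈N₂ , t₁∈may , must⊆may B s₂ N₂ m _ t₂∈N₂)
        (λ (t₂∈N₂ , t₁∈may , _) → pairUp-∈ (may A s₁) N₂ t₁∈may t₂∈N₂)

  fanout-isRefinement : (X A B : DMTS k) {R : REL (St X) (St A) 0ℓ} {Q : REL (St X) (St B) 0ℓ} →
    IsDMTSRefinement X A R → IsDMTSRefinement X B Q → IsDMTSRefinement X (A ∧ᴰ B) ⟨ R , Q ⟩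
  fanout-isRefinement X A B {R} {Q} R-ref Q-ref s (t , u) (sRt , sQu) =
    ⊑-fanout may-⊑₁ may-⊑₂ (λ a t₁ t₂ → pairUp-∈ (may A t) (may B u)) , must
    where
      may-⊑₁ = proj₁ (R-ref s t sRt)
      may-⊑₂ = proj₁ (Q-ref s u sQu)
      ⊆may : ∀ {N} → Must X s N → N ⊆ may X s
      ⊆may m = must⊆may X s _ m _
      must : ∀ N → Must (A ∧ᴰ B) (t , u) N → ∃[ Nₓ ] (Must X s Nₓ × Nₓ ⊑⟨ ⟨ R , Q ⟩ ⟩ N)
      must N (inj₁ (N₁ , m₁ , members)) with proj₂ (R-ref s t sRt) N₁ m₁
      ... | Nₓ , mₓ , Nₓ⊑N₁ =
        Nₓ , mₓ , ⊑-fanout Nₓ⊑N₁ (⊑-⊆ˡ (⊆may mₓ) may-⊑₂)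
          (λ a t₁ t₂ t₁∈N₁ t₂∈may →
            Equivalence.from (members a t₁ t₂) (t₁∈N₁ , must⊆may A t N₁ m₁ _ t₁∈N₁ , t₂∈may))
      must N (inj₂ (N₂ , m₂ , members)) with proj₂ (Q-ref s u sQu) N₂ m₂
      ... | Nₓ , mₓ , Nₓ⊑N₂ =
        Nₓ , mₓ , ⊑-fanout (⊑-⊆ˡ (⊆may mₓ) may-⊑₁) Nₓ⊑N₂
          (λ a t₁ t₂ t₁∈may t₂∈N₂ →
            Equivalence.from (members a t₁ t₂) (t₂∈N₂ , t₁∈may , must⊆may B u N₂ m₂ _ t₂∈N₂))

  ∧-monoʳ-isRefinement : (X A B : DMTS k) {R : REL (St A) (St B) 0ℓ} → IsDMTSRefinement A B R →
    IsDMTSRefinement (X ∧ᴰ A) (X ∧ᴰ B) ⟨ Graph proj₁ , Graph proj₂ ⨾ R ⟩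
  ∧-monoʳ-isRefinement X A B R-ref =
    fanout-isRefinement (X ∧ᴰ A) X B (proj₁-isRefinement X A)
      (⨾-isRefinement (X ∧ᴰ A) A B (proj₂-isRefinement X A) R-ref)

  ⊤ᴰ : DMTS k
  ⊤ᴰ = record
    { St = ⊤ ; init = tt ∷ [] ; may = λ _ → map (λ a → a , tt) (allFin k)
    ; Must = λ _ _ → ⊥ ; must⊆may = λ _ _ () }

  ⊥ᴰ : DMTS k
  ⊥ᴰ = record { St = ⊥ ; init = [] ; may = λ _ → [] ; Must = λ _ _ → ⊥ ; must⊆may = λ _ _ () }

  ≤-refl : (A : DMTS k) → A ≤ₘᴰ A
  ≤-refl A = _≡_ , ≡-isRefinement A , ⊆⟨⟩-refl

  ≤-trans : (A B C : DMTS k) → A ≤ₘᴰ B → B ≤ₘᴰ C → A ≤ₘᴰ C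
  ≤-trans A B C (R , R-ref , R-init) (Q , Q-ref , Q-init) =
    R ⨾ Q , ⨾-isRefinement A B C R-ref Q-ref , ⊆⟨⟩-trans R-init Q-init

  ∨-supremum : Supremum (_≤ₘᴰ_ {k}) _∨ᴰ_
  ∨-supremum A B =
    (Graph inj₁ , inj₁-isRefinement A B , ⊆⟨⟩-++-inj₁ (init A) (init B)) ,
    (Graph inj₂ , inj₂-isRefinement A B , ⊆⟨⟩-++-inj₂ (init A) (init B)) ,
    λ C (R , R-ref , R-init) (Q , Q-ref , Q-init) →
      _ , ∪-isRefinement (A ∨ᴰ B) C (⨾-isRefinement (A ∨ᴰ B) A C (inj₁⁻¹-isRefinement A B) R-ref)
                                    (⨾-isRefinement (A ∨ᴰ B) B C (inj₂⁻¹-isRefinement A B) Q-ref)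
        , ++-⊆⟨⟩ R-init Q-init

  ∧-infimum : Infimum (_≤ₘᴰ_ {k}) _∧ᴰ_
  ∧-infimum A B =
    (Graph proj₁ , proj₁-isRefinement A B , cartesianProduct-⊆⟨⟩-proj₁ (init A) (init B)) ,
    (Graph proj₂ , proj₂-isRefinement A B , cartesianProduct-⊆⟨⟩-proj₂ (init A) (init B)) ,
    λ X (R , R-ref , R-init) (Q , Q-ref , Q-init) →
      ⟨ R , Q ⟩ , fanout-isRefinement X A B R-ref Q-ref , ⊆⟨⟩-cartesianProduct R-init Q-init

  ≤-⊤ : (A : DMTS k) → A ≤ₘᴰ ⊤ᴰ
  ≤-⊤ A = Graph (λ _ → tt) , isRefinement , λ s _ → tt , here refl , refl
    where
      isRefinement : IsDMTSRefinement A ⊤ᴰ (Graph (λ _ → tt))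
      isRefinement s tt refl = (λ a t _ → tt , ∈-map⁺ (λ a → a , tt) (∈-allFin a) , refl) , λ _ ()

  ⊥-≤ : (A : DMTS k) → ⊥ᴰ ≤ₘᴰ A
  ⊥-≤ A = (λ ()) , (λ ()) , λ _ ()

  ∧-distribˡ-∨-≤ : (X Y Z : DMTS k) → (X ∧ᴰ (Y ∨ᴰ Z)) ≤ₘᴰ ((X ∧ᴰ Y) ∨ᴰ (X ∧ᴰ Z))
  ∧-distribˡ-∨-≤ X Y Z =
    Distrib , ∪-isRefinement X∧[Y∨Z] [X∧Y]∨[X∧Z] viaY viaZ ,
    cartesianProduct-++-⊆⟨Distrib⟩ (init X) (init Y) (init Z)
    where
      X∧[Y∨Z] [X∧Y]∨[X∧Z] : DMTS k
      X∧[Y∨Z] = X ∧ᴰ (Y ∨ᴰ Z)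
      [X∧Y]∨[X∧Z] = (X ∧ᴰ Y) ∨ᴰ (X ∧ᴰ Z)

      viaY : IsDMTSRefinement X∧[Y∨Z] [X∧Y]∨[X∧Z]
               (⟨ Graph proj₁ , Graph proj₂ ⨾ flip (Graph inj₁) ⟩ ⨾ Graph inj₁)
      viaY = ⨾-isRefinement X∧[Y∨Z] (X ∧ᴰ Y) [X∧Y]∨[X∧Z]
        (∧-monoʳ-isRefinement X (Y ∨ᴰ Z) Y (inj₁⁻¹-isRefinement Y Z))
        (inj₁-isRefinement (X ∧ᴰ Y) (X ∧ᴰ Z))

      viaZ : IsDMTSRefinement X∧[Y∨Z] [X∧Y]∨[X∧Z]
               (⟨ Graph proj₁ , Graph proj₂ ⨾ flip (Graph inj₂) ⟩ ⨾ Graph inj₂)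
      viaZ = ⨾-isRefinement X∧[Y∨Z] (X ∧ᴰ Z) [X∧Y]∨[X∧Z]
        (∧-monoʳ-isRefinement X (Y ∨ᴰ Z) Z (inj₂⁻¹-isRefinement Y Z))
        (inj₂-isRefinement (X ∧ᴰ Y) (X ∧ᴰ Z))

  isBoundedDistributiveLattice :
    IsBoundedLattice (_≡ₘᴰ_ {k}) _≤ₘᴰ_ _∨ᴰ_ _∧ᴰ_ ⊤ᴰ ⊥ᴰ
    × IsDistributiveLattice (_≡ₘᴰ_ {k}) _≤ₘᴰ_ _∨ᴰ_ _∧ᴰ_
  isBoundedDistributiveLattice =
    boundedDistributiveLattice (λ {A} → ≤-refl A) (λ {A} {B} {C} → ≤-trans A B C)
      ∨-supremum ∧-infimum ≤-⊤ ⊥-≤ ∧-distribˡ-∨-≤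

theorem4 : (k : ℕ)
    → (Σ (NAA k) λ ⊤ → Σ (NAA k) λ ⊥
         → IsBoundedLattice (_≡ₘᴺ_ {k}) (_≤ₘᴺ_ {k}) _∨ᴺ_ _∧ᴺ_ ⊤ ⊥
           × IsDistributiveLattice (_≡ₘᴺ_ {k}) (_≤ₘᴺ_ {k}) _∨ᴺ_ _∧ᴺ_)
    × (Σ (DMTS k) λ ⊤ → Σ (DMTS k) λ ⊥
         → IsBoundedLattice (_≡ₘᴰ_ {k}) (_≤ₘᴰ_ {k}) _∨ᴰ_ _∧ᴰ_ ⊤ ⊥
           × IsDistributiveLattice (_≡ₘᴰ_ {k}) (_≤ₘᴰ_ {k}) _∨ᴰ_ _∧ᴰ_)
theorem4 k =
  (NAALattice.⊤ᴺ , NAALattice.⊥ᴺ , NAALattice.isBoundedDistributiveLattice) ,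
  (DMTSLattice.⊤ᴰ , DMTSLattice.⊥ᴰ , DMTSLattice.isBoundedDistributiveLattice)
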